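{- For $1<k\leq n$, we have $$CUD^{(D)}_{n,k}=CUD^{(D)}_{n,k-1}+t^{ -1}CUD^{(B)}_{n-1,k-1}.$$
   Context: A permutation is written in standard cycle notation: each cycle begins with its smallest entry and the first entries of the cycles increase; it is cycle-up-down if every cycle $(c_1,c_2,\dots,c_r)$ satisfies $c_1<c_2>c_3<\cdots$. A signed permutation of $[n]$ ($\bar i=-i$) decomposes into cycles coming either in pairs $(a_1,\dots,a_r)(\bar a_1,\dots,\bar a_r)$, written $(a_1,\dots,a_r)$, or as single cycles $(a_1,\dots,a_r,\bar a_1,\dots,\bar a_r)$; it is special if it has none of the second kind; $|\sigma|$ takes absolute values of all entries in the cycle notation. $\mathcal{CUD}^{(B)}_n$: special signed permutations $(a_{1,1},a_{1,2},\ldots)\cdots(a_{m,1},\ldots)$ with all $a_{i,1}>0$ and $|\sigma|$ cycle-up-down. $\mathcal{CUD}^{(D)}_n$: signed permutations of the form $(a_{1,1},\ldots)\cdots(a_{m-1,1},\ldots)(a_{m,1},\overline{a_{m,1}})$, no other cycle of the form $(a,\bar a)$, all $a_{i,1}>0$, and $|\sigma|$ cycle-up-down (reading the last cycle as $(a_{m,1})$). $\mathcal{CUD}^{(B)}_{n,k}$, $\mathcal{CUD}^{(D)}_{n,k}$ are the subsets with $a_{m,1}=k$. $\mathsf{npk}(\sigma)=\#\{a_{i,j}<0 : |a_{i,j}|\ge|a_{i,j-1}|\}$, with the element $i$ of the last cycle $(i,\bar i)$ of a type $D$ permutation also contributing $1$. Define $CUD^{(B)}_{n,k}(t)=\sum_{\sigma\in\mathcal{CUD}^{(B)}_{n,k}}t^{n+1-2\,\mathsf{npk}(\sigma)}$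 and $CUD^{(D)}_{n,k}(t)=\sum_{\sigma\in\mathcal{CUD}^{(D)}_{n,k}}t^{n+1-2\,\mathsf{npk}(\sigma)}$. -}

module Defs where

open import Data.Bool using (Bool; true; false; _∧_; not; if_then_else_)
open import Data.Nat using (ℕ; zero; suc; _+_; _*_; _<ᵇ_; _≤ᵇ_; _≡ᵇ_)
open import Data.Integer using (ℤ; +_; -_; ∣_∣; _-_; -[1+_])
import Data.Integer as ℤ
open import Data.List using (List; []; _∷_; [_]; _++_; map; concatMap; length; upTo; filterᵇ)
open import Data.Bool.ListAction using (all; any)
open import Data.Nat.ListAction using (sum)
open import Relation.Nullary.Decidable using (does)

range : ℕ → List ℕ
range n = map suc (upTo n)

remove : ℕ → List ℕ → List ℕ
remove a = filterᵇ (λ x → not (x ≡ᵇ a))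

insertions : {A : Set} → A → List A → List (List A)
insertions x []       = (x ∷ []) ∷ []
insertions x (y ∷ ys) = (x ∷ y ∷ ys) ∷ map (y ∷_) (insertions x ys)

perms : {A : Set} → List A → List (List A)
perms []       = [] ∷ []
perms (x ∷ xs) = concatMap (insertions x) (perms xs)

signings : List ℕ → List (List ℤ)
signings []       = [] ∷ []
signings (x ∷ xs) = concatMap (λ r → ((+ x) ∷ r) ∷ ((- (+ x)) ∷ r) ∷ []) (signings xs)

splits : {A : Set} → List A → List (List (List A))
splits {A} []       = [] ∷ []
splits {A} (x ∷ xs) = concatMap ext (splits xs)
  where
  ext : List (List A) → List (List (List A))
  ext []       = ((x ∷ []) ∷ []) ∷ []
  ext (b ∷ bs) = ((x ∷ []) ∷ b ∷ bs) ∷ ((x ∷ b) ∷ bs) ∷ []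

-- A cycle notation is a list of cycles, each cycle a list of signed
-- entries (ℤ, with ī = -i).  A paired cycle (a₁…a_r)(ā₁…ā_r) is written
-- as the single list a₁ ∷ … ∷ a_r.

Notation : Set
Notation = List (List ℤ)

-- All candidate notations of special signed permutations of [n]:
-- a signed arrangement of 1..n cut into consecutive cycles.
-- (Every cycle notation of a special signed permutation of [n] occurs
-- exactly once in this list.)
notationsB : ℕ → List Notation
notationsB n = concatMap splits (concatMap signings (perms (range n)))

-- All candidate notations of the type D shape
--   (a_{1,1},…)⋯(a_{m-1,1},…)(a, ā)   with a ∈ [n], a > 0,
-- where the first m-1 (paired) cycles use the letters [n] ∖ {a}.
notationsD : ℕ → List Notation
notationsD n =
  concatMap
    (λ a → map (λ cs → cs ++ [ (+ a) ∷ (- (+ a)) ∷ [] ])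
               (concatMap splits (concatMap signings (perms (remove a (range n))))))
    (range n)

upDown : Bool → List ℕ → Bool
upDown up (x ∷ y ∷ r) = (if up then x <ᵇ y else y <ᵇ x) ∧ upDown (not up) (y ∷ r)
upDown up _           = true

startsWithMin : List ℕ → Bool
startsWithMin []      = false
startsWithMin (x ∷ r) = all (x <ᵇ_) r

headsIncrease : List (List ℕ) → Bool
headsIncrease ((x ∷ _) ∷ (y ∷ r) ∷ cs) = (x <ᵇ y) ∧ headsIncrease ((y ∷ r) ∷ cs)
headsIncrease _                        = true

isStandard : List (List ℕ) → Bool
isStandard cs = all startsWithMin cs ∧ headsIncrease cs

isCycleUpDown : List (List ℕ) → Bool
isCycleUpDown cs = isStandard cs ∧ all (upDown true) cs

isPos : ℤ → Bool
isPos (+ suc _) = true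
isPos _         = false

isNeg : ℤ → Bool
isNeg -[1+ _ ] = true
isNeg _        = false

firstPos : List ℤ → Bool
firstPos []      = false
firstPos (x ∷ _) = isPos x

absCycle : List ℤ → List ℕ
absCycle = map ∣_∣

absB : Notation → List (List ℕ)
absB = map absCycle

initCycles : Notation → Notation
initCycles []           = []
initCycles (c ∷ [])     = []
initCycles (c ∷ d ∷ cs) = c ∷ initCycles (d ∷ cs)

lastCycle : Notation → List ℤ
lastCycle []           = []
lastCycle (c ∷ [])     = c
lastCycle (c ∷ d ∷ cs) = lastCycle (d ∷ cs)

lastFirst : Notation → ℕ
lastFirst σ with lastCycle σ
... | []    = 0
... | x ∷ _ = ∣ x ∣

lastIsPair : Notation → Bool
lastIsPair σ with lastCycle σ
... | x ∷ y ∷ [] = isPos x ∧ does (y ℤ.≟ (- x))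
... | _          = false

isPairCycle : List ℤ → Bool
isPairCycle (x ∷ y ∷ []) = does (y ℤ.≟ (- x))
isPairCycle _            = false

-- |σ| for type D notations: the last cycle (a, ā) is read as (a)
absD : Notation → List (List ℕ)
absD σ = absB (initCycles σ) ++ [ map ∣_∣ (firstOf (lastCycle σ)) ]
  where
  firstOf : List ℤ → List ℤ
  firstOf []      = []
  firstOf (x ∷ _) = x ∷ []

npkCycle : List ℤ → ℕ
npkCycle (x ∷ y ∷ r) =
  (if isNeg y ∧ (∣ x ∣ ≤ᵇ ∣ y ∣) then 1 else 0) + npkCycle (y ∷ r)
npkCycle _           = 0

npkB : Notation → ℕ
npkB σ = sum (map npkCycle σ)

-- type D: the non-last cycles, plus 1 for the element of (i, ī)
npkD : Notation → ℕ
npkD σ = npkB (initCycles σ) + 1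

isCUDB : ℕ → ℕ → Notation → Bool
isCUDB n k σ = all firstPos σ ∧ isCycleUpDown (absB σ) ∧ (lastFirst σ ≡ᵇ k)

isCUDD : ℕ → ℕ → Notation → Bool
isCUDD n k σ =
  lastIsPair σ ∧ not (any isPairCycle (initCycles σ))
  ∧ all firstPos σ ∧ isCycleUpDown (absD σ) ∧ (lastFirst σ ≡ᵇ k)

cudB : ℕ → ℕ → List Notation
cudB n k = filterᵇ (isCUDB n k) (notationsB n)

cudD : ℕ → ℕ → List Notation
cudD n k = filterᵇ (isCUDD n k) (notationsD n)

-- Laurent polynomials in t with natural coefficients, as coefficient
-- functions ℤ → ℕ  (P e = coefficient of t^e).

LPoly : Set
LPoly = ℤ → ℕ

-- Σ_{x ∈ xs} t^{w x}
genFun : {X : Set} → List X → (X → ℤ) → LPoly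
genFun xs w e = length (filterᵇ (λ x → does (w x ℤ.≟ e)) xs)

_⊕_ : LPoly → LPoly → LPoly
(P ⊕ Q) e = P e + Q e

-- multiplication by t^{-1}
tInv : LPoly → LPoly
tInv P e = P (e ℤ.+ + 1)

expo : ℕ → ℕ → ℤ
expo n m = + (n + 1) - + (2 * m)

CUDB : ℕ → ℕ → LPoly
CUDB n k = genFun (cudB n k) (λ σ → expo n (npkB σ))

CUDD : ℕ → ℕ → LPoly
CUDD n k = genFun (cudD n k) (λ σ → expo n (npkD σ))

-- Removing the final cycle (k, k̄) from an element of CUD^(D)_{n,k} and relabelling
-- [n] ∖ {k} increasingly onto [n - 1] is a bijection onto the elements of CUD^(B)_{n-1}
-- whose last cycle starts below k.  An increasing relabelling preserves signs, the
-- cycle-up-down shape and npk, while the cycle (k, k̄) adds one to npk; hence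
-- CUD^(D)_{n,k} = t⁻¹ Σ_{j<k} CUD^(B)_{n-1,j}, and the recursion is the difference of
-- two consecutive such sums.

module Submission where

open import Defs
open import Data.Bool using (Bool; true; false; _∧_; not; T; if_then_else_)
open import Data.Bool.ListAction using (all; any; and)
open import Data.Bool.Properties using (∧-identityʳ; ∧-zeroʳ; ∧-assoc; ∧-comm)
open import Data.Nat using (ℕ; zero; suc; _+_; _*_; _∸_; _<_; _≤_; _<ᵇ_; _≤ᵇ_; _≡ᵇ_; z≤n; s≤s; z<s; s<s)
open import Data.Nat.Properties using (+-suc; +-comm; <⇒≤; _≟_; <ᵇ⇒<; _<?_; _≤?_; <-cmp; <-irrefl; <-asym; ≮⇒≥; <⇒≱; *-distribˡ-+)
open import Data.Integer using (ℤ; +_; -_; -[1+_]; ∣_∣)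
import Data.Integer as ℤ
import Data.Integer.Properties as ℤ
open import Data.Integer.Tactic.RingSolver using (solve-∀)
open import Algebra.Properties.AbelianGroup ℤ.+-0-abelianGroup using (∙-cancelʳ)
open import Data.List using (List; []; _∷_; [_]; _++_; map; concatMap; length; filterᵇ; upTo)
open import Data.List.Properties
  using (length-++; map-∘; concatMap-map; map-concatMap; concatMap-cong; filter-++; filter-all; filter-none; map-upTo; ++-identityʳ; map-cong)
open import Data.List.Relation.Unary.All using (All; []; _∷_; universal)
import Data.List.Relation.Unary.All as All
open import Data.List.Relation.Unary.All.Properties using (map⁺; concat⁺)
open import Data.Empty using (⊥)
open import Data.Unit using (⊤; tt)
open import Function using (_∘_; mk⇔)
open import Relation.Binary.Core using (_Preserves_⟶_)
open import Relation.Binary.Definitions using (tri<; tri≈; tri>)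
open import Relation.Binary.PropositionalEquality using (_≡_; refl; sym; trans; cong; cong₂; subst; module ≡-Reasoning)
open import Relation.Nullary using (does; T?; yes; no; contradiction)
open import Relation.Nullary.Decidable using (does-⇔; dec-true)

private variable
  A B C D : Set

count : (A → Bool) → List A → ℕ
count p xs = length (filterᵇ p xs)

count-++ : (p : A → Bool) (xs ys : List A) → count p (xs ++ ys) ≡ count p xs + count p ys
count-++ p xs ys = trans (cong length (filter-++ (T? ∘ p) xs ys)) (length-++ (filterᵇ p xs))

count-map : (p : B → Bool) (f : A → B) (xs : List A) → count p (map f xs) ≡ count (p ∘ f) xs
count-map p f [] = refl
count-map p f (x ∷ xs) with p (f x)
... | true  = cong suc (count-map p f xs)
... | false = count-map p f xs

count-cong-local : {p q : A → Bool} {xs : List A} → All (λ x → p x ≡ q x) xs → count p xs ≡ count q xs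
count-cong-local {p = p} {q} {x ∷ xs} (_ ∷ eqs) with p x | q x
count-cong-local (refl ∷ eqs) | true  | .true  = cong suc (count-cong-local eqs)
count-cong-local (refl ∷ eqs) | false | .false = count-cong-local eqs
count-cong-local [] = refl

count-filterᵇ : (p q : A → Bool) (xs : List A) → count q (filterᵇ p xs) ≡ count (λ x → p x ∧ q x) xs
count-filterᵇ p q [] = refl
count-filterᵇ p q (x ∷ xs) with p x
... | false = count-filterᵇ p q xs
... | true with q x
...   | true  = cong suc (count-filterᵇ p q xs)
...   | false = count-filterᵇ p q xs

count-split : (p h : A → Bool) (xs : List A) →
  count p xs ≡ count (λ x → p x ∧ h x) xs + count (λ x → p x ∧ not (h x)) xs
count-split p h [] = refl
count-split p h (x ∷ xs) with p x | h x
... | false | _     = count-split p h xs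
... | true  | true  = cong suc (count-split p h xs)
... | true  | false = trans (cong suc (count-split p h xs)) (sym (+-suc _ _))

count-none : {p : A → Bool} {xs : List A} → All (λ x → p x ≡ false) xs → count p xs ≡ 0
count-none [] = refl
count-none {p = p} {x ∷ xs} (_ ∷ rest) with p x
count-none (() ∷ rest) | true
... | false = count-none rest

count-concatMap-filterᵇ : (p : B → Bool) (g : A → List B) (q : A → Bool) {xs : List A} →
  All (λ a → q a ≡ false → count p (g a) ≡ 0) xs →
  count p (concatMap g xs) ≡ count p (concatMap g (filterᵇ q xs))
count-concatMap-filterᵇ p g q [] = refl
count-concatMap-filterᵇ p g q {x ∷ xs} (vanish ∷ rest) with q x
... | true = trans (count-++ p (g x) (concatMap g xs))
               (trans (cong (_+_ (count p (g x))) (count-concatMap-filterᵇ p g q rest))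
                 (sym (count-++ p (g x) (concatMap g (filterᵇ q xs)))))
... | false = trans (count-++ p (g x) (concatMap g xs))
                (cong₂ _+_ (vanish refl) (count-concatMap-filterᵇ p g q rest))

concatMap-natural : {f : A → B} {g : A → List C} {g′ : B → List D} {h : C → D} →
  (∀ x → g′ (f x) ≡ map h (g x)) → ∀ xs → concatMap g′ (map f xs) ≡ map h (concatMap g xs)
concatMap-natural {f = f} {g} {g′} {h} eq xs = begin
  concatMap g′ (map f xs)   ≡⟨ concatMap-map g′ f xs ⟩
  concatMap (g′ ∘ f) xs     ≡⟨ concatMap-cong eq xs ⟩
  concatMap (map h ∘ g) xs  ≡⟨ map-concatMap h g xs ⟨
  map h (concatMap g xs)    ∎
  where open ≡-Reasoning

insertions-map : (f : A → B) (x : A) (ys : List A) →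
  insertions (f x) (map f ys) ≡ map (map f) (insertions x ys)
insertions-map f x [] = refl
insertions-map f x (y ∷ ys) = cong ((f x ∷ f y ∷ map f ys) ∷_) (begin
  map (f y ∷_) (insertions (f x) (map f ys))  ≡⟨ cong (map (f y ∷_)) (insertions-map f x ys) ⟩
  map (f y ∷_) (map (map f) (insertions x ys)) ≡⟨ map-∘ (insertions x ys) ⟨
  map (map f ∘ (y ∷_)) (insertions x ys)       ≡⟨ map-∘ (insertions x ys) ⟩
  map (map f) (map (y ∷_) (insertions x ys))   ∎)
  where open ≡-Reasoning

perms-map : (f : A → B) (xs : List A) → perms (map f xs) ≡ map (map f) (perms xs)
perms-map f [] = refl
perms-map f (x ∷ xs) = trans (cong (concatMap (insertions (f x))) (perms-map f xs))
  (concatMap-natural (insertions-map f x) (perms xs))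

splits-map : (f : A → B) (xs : List A) → splits (map f xs) ≡ map (map (map f)) (splits xs)
splits-map f [] = refl
splits-map f (x ∷ xs) = trans (cong (concatMap _) (splits-map f xs))
  (concatMap-natural (λ { [] → refl ; (b ∷ bs) → refl }) (splits xs))

relabel : (ℕ → ℕ) → ℤ → ℤ
relabel f (+ m)    = + f m
relabel f -[1+ m ] = - (+ f (suc m))

relabel-neg : (f : ℕ → ℕ) → f 0 ≡ 0 → ∀ x → relabel f (- (+ x)) ≡ - (+ f x)
relabel-neg f f0≡0 zero    rewrite f0≡0 = refl
relabel-neg f f0≡0 (suc x) = refl

signings-map : (f : ℕ → ℕ) → f 0 ≡ 0 → (xs : List ℕ) →
  signings (map f xs) ≡ map (map (relabel f)) (signings xs)
signings-map f f0≡0 [] = refl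
signings-map f f0≡0 (x ∷ xs) = trans (cong (concatMap _) (signings-map f f0≡0 xs))
  (concatMap-natural (λ r → cong (λ z → (+ f x ∷ map (relabel f) r) ∷ (z ∷ map (relabel f) r) ∷ [])
                                 (sym (relabel-neg f f0≡0 x)))
                     (signings xs))

cycleNotations : List ℕ → List Notation
cycleNotations xs = concatMap splits (concatMap signings (perms xs))

relabelNotation : (ℕ → ℕ) → Notation → Notation
relabelNotation f = map (map (relabel f))

cycleNotations-map : (f : ℕ → ℕ) → f 0 ≡ 0 → (xs : List ℕ) →
  cycleNotations (map f xs) ≡ map (relabelNotation f) (cycleNotations xs)
cycleNotations-map f f0≡0 xs = begin
  concatMap splits (concatMap signings (perms (map f xs)))
    ≡⟨ cong (concatMap splits ∘ concatMap signings) (perms-map f xs) ⟩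
  concatMap splits (concatMap signings (map (map f) (perms xs)))
    ≡⟨ cong (concatMap splits) (concatMap-natural (signings-map f f0≡0) (perms xs)) ⟩
  concatMap splits (map (map (relabel f)) (concatMap signings (perms xs)))
    ≡⟨ concatMap-natural (splits-map (relabel f)) (concatMap signings (perms xs)) ⟩
  map (relabelNotation f) (cycleNotations xs)
    ∎
  where open ≡-Reasoning

NonEmpty : List A → Set
NonEmpty []      = ⊥
NonEmpty (_ ∷ _) = ⊤

splits-nonEmpty : (xs : List A) → All (All NonEmpty) (splits xs)
splits-nonEmpty [] = [] ∷ []
splits-nonEmpty (x ∷ xs) = concat⁺ (map⁺ (All.map
  (λ { {[]} [] → (tt ∷ []) ∷ [] ; {b ∷ bs} (nb ∷ nbs) → (tt ∷ nb ∷ nbs) ∷ (tt ∷ nbs) ∷ [] })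
  (splits-nonEmpty xs)))

cycleNotations-nonEmpty : (xs : List ℕ) → All (All NonEmpty) (cycleNotations xs)
cycleNotations-nonEmpty xs = concat⁺ (map⁺ (universal splits-nonEmpty (concatMap signings (perms xs))))

all-++ : (p : A → Bool) (xs ys : List A) → all p (xs ++ ys) ≡ all p xs ∧ all p ys
all-++ p []       ys = refl
all-++ p (x ∷ xs) ys = trans (cong (p x ∧_) (all-++ p xs ys)) (sym (∧-assoc (p x) (all p xs) (all p ys)))

headAbs : List ℤ → ℕ
headAbs []      = 0
headAbs (x ∷ _) = ∣ x ∣

lastFirst≡headAbs∘lastCycle : (σ : Notation) → lastFirst σ ≡ headAbs (lastCycle σ)
lastFirst≡headAbs∘lastCycle σ with lastCycle σ
... | []    = refl
... | _ ∷ _ = refl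

lastFirst-∷ : (c d : List ℤ) (σ : Notation) → lastFirst (c ∷ d ∷ σ) ≡ lastFirst (d ∷ σ)
lastFirst-∷ c d σ =
  trans (lastFirst≡headAbs∘lastCycle (c ∷ d ∷ σ)) (sym (lastFirst≡headAbs∘lastCycle (d ∷ σ)))

lastCycle-snoc : (σ : Notation) (c : List ℤ) → lastCycle (σ ++ [ c ]) ≡ c
lastCycle-snoc []          c = refl
lastCycle-snoc (d ∷ [])    c = refl
lastCycle-snoc (d ∷ e ∷ σ) c = lastCycle-snoc (e ∷ σ) c

initCycles-snoc : (σ : Notation) (c : List ℤ) → initCycles (σ ++ [ c ]) ≡ σ
initCycles-snoc []          c = refl
initCycles-snoc (d ∷ [])    c = refl
initCycles-snoc (d ∷ e ∷ σ) c = cong (d ∷_) (initCycles-snoc (e ∷ σ) c)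

headsIncrease-snoc : (a : ℕ) (σ : Notation) → All NonEmpty σ →
  headsIncrease (absB σ ++ [ suc a ∷ [] ]) ≡ headsIncrease (absB σ) ∧ (lastFirst σ <ᵇ suc a)
headsIncrease-snoc a [] [] = refl
headsIncrease-snoc a ((x ∷ c) ∷ []) (_ ∷ []) = ∧-identityʳ (∣ x ∣ <ᵇ suc a)
headsIncrease-snoc a ((x ∷ c) ∷ [] ∷ σ) (_ ∷ () ∷ _)
headsIncrease-snoc a ((x ∷ c) ∷ (y ∷ d) ∷ σ) (_ ∷ ne) = begin
  (∣ x ∣ <ᵇ ∣ y ∣) ∧ headsIncrease (absB ((y ∷ d) ∷ σ) ++ [ suc a ∷ [] ])
    ≡⟨ cong ((∣ x ∣ <ᵇ ∣ y ∣) ∧_) (headsIncrease-snoc a ((y ∷ d) ∷ σ) ne) ⟩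
  (∣ x ∣ <ᵇ ∣ y ∣) ∧ headsIncrease (absB ((y ∷ d) ∷ σ)) ∧ (lastFirst ((y ∷ d) ∷ σ) <ᵇ suc a)
    ≡⟨ ∧-assoc (∣ x ∣ <ᵇ ∣ y ∣) _ _ ⟨
  ((∣ x ∣ <ᵇ ∣ y ∣) ∧ headsIncrease (absB ((y ∷ d) ∷ σ))) ∧ (lastFirst ((y ∷ d) ∷ σ) <ᵇ suc a)
    ≡⟨ cong (λ l → _ ∧ (l <ᵇ suc a)) (lastFirst-∷ (x ∷ c) (y ∷ d) σ) ⟨
  headsIncrease (absB ((x ∷ c) ∷ (y ∷ d) ∷ σ)) ∧ (lastFirst ((x ∷ c) ∷ (y ∷ d) ∷ σ) <ᵇ suc a)
    ∎
  where open ≡-Reasoning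

∧-swap-last : ∀ s h l u → (s ∧ (h ∧ l)) ∧ u ≡ ((s ∧ h) ∧ u) ∧ l
∧-swap-last false h l u = refl
∧-swap-last true false l u = refl
∧-swap-last true true l u = ∧-comm l u

isCycleUpDown-snoc : (a : ℕ) (σ : Notation) → All NonEmpty σ →
  isCycleUpDown (absB σ ++ [ suc a ∷ [] ]) ≡ isCycleUpDown (absB σ) ∧ (lastFirst σ <ᵇ suc a)
isCycleUpDown-snoc a σ ne = begin
  (all startsWithMin (cs ++ [ suc a ∷ [] ]) ∧ headsIncrease (cs ++ [ suc a ∷ [] ])) ∧ all (upDown true) (cs ++ [ suc a ∷ [] ])
    ≡⟨ cong₂ (λ s u → (s ∧ headsIncrease (cs ++ [ suc a ∷ [] ])) ∧ u)
         (trans (all-++ startsWithMin cs _) (∧-identityʳ _)) (trans (all-++ (upDown true) cs _) (∧-identityʳ _)) ⟩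
  (all startsWithMin cs ∧ headsIncrease (cs ++ [ suc a ∷ [] ])) ∧ all (upDown true) cs
    ≡⟨ cong (λ h → (all startsWithMin cs ∧ h) ∧ all (upDown true) cs) (headsIncrease-snoc a σ ne) ⟩
  (all startsWithMin cs ∧ (headsIncrease cs ∧ (lastFirst σ <ᵇ suc a))) ∧ all (upDown true) cs
    ≡⟨ ∧-swap-last (all startsWithMin cs) (headsIncrease cs) _ _ ⟩
  isCycleUpDown cs ∧ (lastFirst σ <ᵇ suc a)
    ∎
  where
  open ≡-Reasoning
  cs : List (List ℕ)
  cs = absB σ

T-∧₁ : ∀ x {y} → T (x ∧ y) → T x
T-∧₁ true _ = tt

T-∧₂ : ∀ x {y} → T (x ∧ y) → T y
T-∧₂ true t = t

upDown-pairCycle : (c : List ℤ) → T (upDown true (absCycle c)) → isPairCycle c ≡ false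
upDown-pairCycle []              _ = refl
upDown-pairCycle (x ∷ [])        _ = refl
upDown-pairCycle (x ∷ y ∷ z ∷ c) _ = refl
upDown-pairCycle (x ∷ y ∷ [])    t with y ℤ.≟ - x
... | no _     = refl
... | yes refl = contradiction (<ᵇ⇒< ∣ x ∣ ∣ - x ∣ (T-∧₁ (∣ x ∣ <ᵇ ∣ - x ∣) t)) (<-irrefl (sym (ℤ.∣-i∣≡∣i∣ x)))

upDown⇒noPairCycle : (σ : Notation) → T (all (upDown true) (absB σ)) → any isPairCycle σ ≡ false
upDown⇒noPairCycle []      _ = refl
upDown⇒noPairCycle (c ∷ σ) t
  rewrite upDown-pairCycle c (T-∧₁ (upDown true (absCycle c)) t)
  = upDown⇒noPairCycle σ (T-∧₂ (upDown true (absCycle c)) t)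

isCUDBelow : ℕ → Notation → Bool
isCUDBelow k σ = all firstPos σ ∧ isCycleUpDown (absB σ) ∧ (lastFirst σ <ᵇ k)

pairCycle : ℕ → List ℤ
pairCycle a = + a ∷ - (+ a) ∷ []

lastIsPair-snoc : (σ : Notation) (a : ℕ) → lastIsPair (σ ++ [ pairCycle (suc a) ]) ≡ true
lastIsPair-snoc σ a rewrite lastCycle-snoc σ (pairCycle (suc a)) = dec-true (-[1+ a ] ℤ.≟ -[1+ a ]) refl

absD-snoc : (σ : Notation) (x : ℤ) (c : List ℤ) → absD (σ ++ [ x ∷ c ]) ≡ absB σ ++ [ ∣ x ∣ ∷ [] ]
absD-snoc σ x c rewrite initCycles-snoc σ (x ∷ c) | lastCycle-snoc σ (x ∷ c) = refl

lastFirst-snoc : (σ : Notation) (x : ℤ) (c : List ℤ) → lastFirst (σ ++ [ x ∷ c ]) ≡ ∣ x ∣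
lastFirst-snoc σ x c = trans (lastFirst≡headAbs∘lastCycle (σ ++ [ x ∷ c ])) (cong headAbs (lastCycle-snoc σ (x ∷ c)))

guard-∧ : ∀ g x → (T x → g ≡ true) → g ∧ x ≡ x
guard-∧ g false _   = ∧-zeroʳ g
guard-∧ g true  x⇒g = cong (_∧ true) (x⇒g tt)

-- The requirement that no other cycle has the form (a, ā) is implied by cycle-up-down.
isCUDD-snoc : ∀ n k a (σ : Notation) → All NonEmpty σ →
  isCUDD n k (σ ++ [ pairCycle (suc a) ]) ≡ isCUDBelow (suc a) σ ∧ (suc a ≡ᵇ k)
isCUDD-snoc n k a σ ne
  rewrite absD-snoc σ (+ suc a) (- (+ suc a) ∷ []) | lastFirst-snoc σ (+ suc a) (- (+ suc a) ∷ [])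
        | lastIsPair-snoc σ a | initCycles-snoc σ (pairCycle (suc a)) | all-++ firstPos σ [ pairCycle (suc a) ]
        | isCycleUpDown-snoc a σ ne | ∧-identityʳ (all firstPos σ)
  = trans (guard-∧ _ _ λ t → cong not (upDown⇒noPairCycle σ (upDowns t)))
          (sym (∧-assoc (all firstPos σ) _ (suc a ≡ᵇ k)))
  where
  upDowns : T (all firstPos σ ∧ (isCycleUpDown (absB σ) ∧ (lastFirst σ <ᵇ suc a)) ∧ (suc a ≡ᵇ k)) →
            T (all (upDown true) (absB σ))
  upDowns t = T-∧₂ (isStandard (absB σ)) (T-∧₁ (isCycleUpDown (absB σ))
                (T-∧₁ (isCycleUpDown (absB σ) ∧ (lastFirst σ <ᵇ suc a)) (T-∧₂ (all firstPos σ) t)))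

all-map-cong : {p : B → Bool} {q : A → Bool} {f : A → B} → (∀ x → p (f x) ≡ q x) →
  ∀ xs → all p (map f xs) ≡ all q xs
all-map-cong eq xs = cong and (trans (sym (map-∘ xs)) (map-cong eq xs))

module Relabel (f : ℕ → ℕ) (f0≡0 : f 0 ≡ 0) (f-mono : f Preserves _<_ ⟶ _<_) where

  f-cancel-< : ∀ {x y} → f x < f y → x < y
  f-cancel-< {x} {y} fx<fy with <-cmp x y
  ... | tri< x<y _ _  = x<y
  ... | tri≈ _ refl _ = contradiction fx<fy (<-irrefl refl)
  ... | tri> _ _ y<x  = contradiction (f-mono y<x) (<-asym fx<fy)

  <ᵇ-relabel : ∀ x y → (f x <ᵇ f y) ≡ (x <ᵇ y)
  <ᵇ-relabel x y = does-⇔ (mk⇔ f-cancel-< f-mono) (f x <? f y) (x <? y)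

  ≤ᵇ-relabel : ∀ x y → (f x ≤ᵇ f y) ≡ (x ≤ᵇ y)
  ≤ᵇ-relabel x y = does-⇔
    (mk⇔ (λ fx≤fy → ≮⇒≥ (λ y<x → <⇒≱ (f-mono y<x) fx≤fy)) (λ x≤y → ≮⇒≥ (λ fy<fx → <⇒≱ (f-cancel-< fy<fx) x≤y)))
    (f x ≤? f y) (x ≤? y)

  f-suc-positive : ∀ m → 0 < f (suc m)
  f-suc-positive m = subst (_< f (suc m)) f0≡0 (f-mono z<s)

  ∣relabel∣ : ∀ z → ∣ relabel f z ∣ ≡ f ∣ z ∣
  ∣relabel∣ (+ m)    = refl
  ∣relabel∣ -[1+ m ] = ℤ.∣-i∣≡∣i∣ (+ f (suc m))

  isPos-relabel : ∀ z → isPos (relabel f z) ≡ isPos z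
  isPos-relabel (+ zero) rewrite f0≡0 = refl
  isPos-relabel (+ suc m) with f (suc m) | f-suc-positive m
  ... | suc _ | _ = refl
  isPos-relabel -[1+ m ] with f (suc m) | f-suc-positive m
  ... | suc _ | _ = refl

  isNeg-relabel : ∀ z → isNeg (relabel f z) ≡ isNeg z
  isNeg-relabel (+ m) = refl
  isNeg-relabel -[1+ m ] with f (suc m) | f-suc-positive m
  ... | suc _ | _ = refl

  npkCycle-relabel : ∀ c → npkCycle (map (relabel f) c) ≡ npkCycle c
  npkCycle-relabel []          = refl
  npkCycle-relabel (x ∷ [])    = refl
  npkCycle-relabel (x ∷ y ∷ c) = cong₂ _+_
    (cong (λ b → if b then 1 else 0)
      (cong₂ _∧_ (isNeg-relabel y) (trans (cong₂ _≤ᵇ_ (∣relabel∣ x) (∣relabel∣ y)) (≤ᵇ-relabel ∣ x ∣ ∣ y ∣))))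
    (npkCycle-relabel (y ∷ c))

  npkB-relabel : ∀ σ → npkB (relabelNotation f σ) ≡ npkB σ
  npkB-relabel []      = refl
  npkB-relabel (c ∷ σ) = cong₂ _+_ (npkCycle-relabel c) (npkB-relabel σ)

  allFirstPos-relabel : ∀ σ → all firstPos (relabelNotation f σ) ≡ all firstPos σ
  allFirstPos-relabel = all-map-cong λ { [] → refl ; (x ∷ c) → isPos-relabel x }

  absB-relabel : ∀ σ → absB (relabelNotation f σ) ≡ map (map f) (absB σ)
  absB-relabel σ = trans (sym (map-∘ σ)) (trans (map-cong absCycle-relabel σ) (map-∘ σ))
    where
    absCycle-relabel : ∀ c → absCycle (map (relabel f) c) ≡ map f (absCycle c)
    absCycle-relabel c = trans (sym (map-∘ c)) (trans (map-cong ∣relabel∣ c) (map-∘ c))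

  upDown-relabel : ∀ b c → upDown b (map f c) ≡ upDown b c
  upDown-relabel b     []          = refl
  upDown-relabel b     (x ∷ [])    = refl
  upDown-relabel true  (x ∷ y ∷ c) = cong₂ _∧_ (<ᵇ-relabel x y) (upDown-relabel false (y ∷ c))
  upDown-relabel false (x ∷ y ∷ c) = cong₂ _∧_ (<ᵇ-relabel y x) (upDown-relabel true (y ∷ c))

  headsIncrease-relabel : ∀ cs → headsIncrease (map (map f) cs) ≡ headsIncrease cs
  headsIncrease-relabel []                        = refl
  headsIncrease-relabel ([] ∷ cs)                 = refl
  headsIncrease-relabel ((x ∷ c) ∷ [])            = refl
  headsIncrease-relabel ((x ∷ c) ∷ [] ∷ cs)       = refl
  headsIncrease-relabel ((x ∷ c) ∷ (y ∷ d) ∷ cs) =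
    cong₂ _∧_ (<ᵇ-relabel x y) (headsIncrease-relabel ((y ∷ d) ∷ cs))

  isCycleUpDown-relabel : ∀ cs → isCycleUpDown (map (map f) cs) ≡ isCycleUpDown cs
  isCycleUpDown-relabel cs = cong₂ _∧_
    (cong₂ _∧_ (all-map-cong startsWithMin-relabel cs) (headsIncrease-relabel cs))
    (all-map-cong (upDown-relabel true) cs)
    where
    startsWithMin-relabel : ∀ c → startsWithMin (map f c) ≡ startsWithMin c
    startsWithMin-relabel []      = refl
    startsWithMin-relabel (x ∷ r) = all-map-cong (<ᵇ-relabel x) r

  lastFirst-relabel : ∀ σ → lastFirst (relabelNotation f σ) ≡ f (lastFirst σ)
  lastFirst-relabel σ = begin
    lastFirst (relabelNotation f σ)                ≡⟨ lastFirst≡headAbs∘lastCycle (relabelNotation f σ) ⟩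
    headAbs (lastCycle (relabelNotation f σ))      ≡⟨ cong headAbs (lastCycle-relabel σ) ⟩
    headAbs (map (relabel f) (lastCycle σ))        ≡⟨ headAbs-relabel (lastCycle σ) ⟩
    f (headAbs (lastCycle σ))                      ≡⟨ cong f (lastFirst≡headAbs∘lastCycle σ) ⟨
    f (lastFirst σ)                                ∎
    where
    open ≡-Reasoning
    lastCycle-relabel : ∀ σ → lastCycle (relabelNotation f σ) ≡ map (relabel f) (lastCycle σ)
    lastCycle-relabel []          = refl
    lastCycle-relabel (c ∷ [])    = refl
    lastCycle-relabel (c ∷ d ∷ σ) = lastCycle-relabel (d ∷ σ)
    headAbs-relabel : ∀ c → headAbs (map (relabel f) c) ≡ f (headAbs c)
    headAbs-relabel []      = sym f0≡0
    headAbs-relabel (x ∷ c) = ∣relabel∣ x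

  isCUDBelow-relabel : ∀ k → (∀ x → (f x <ᵇ k) ≡ (x <ᵇ k)) →
    ∀ σ → isCUDBelow k (relabelNotation f σ) ≡ isCUDBelow k σ
  isCUDBelow-relabel k below σ = cong₂ _∧_ (allFirstPos-relabel σ) (cong₂ _∧_
    (trans (cong isCycleUpDown (absB-relabel σ)) (isCycleUpDown-relabel (absB σ)))
    (trans (cong (_<ᵇ k) (lastFirst-relabel σ)) (below (lastFirst σ))))

punchIn : ℕ → ℕ → ℕ
punchIn zero    x       = suc x
punchIn (suc k) zero    = zero
punchIn (suc k) (suc x) = suc (punchIn k x)

punchIn-mono : ∀ k → punchIn k Preserves _<_ ⟶ _<_
punchIn-mono zero    x<y                 = s<s x<y
punchIn-mono (suc k) {zero}  {suc y} _   = z<s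
punchIn-mono (suc k) {suc x} {suc y} (s<s x<y) = s<s (punchIn-mono k x<y)

punchIn-<ᵇ : ∀ k x → (punchIn k x <ᵇ k) ≡ (x <ᵇ k)
punchIn-<ᵇ zero    x       = refl
punchIn-<ᵇ (suc k) zero    = refl
punchIn-<ᵇ (suc k) (suc x) = punchIn-<ᵇ k x

filterᵇ-map : (p : B → Bool) (f : A → B) (xs : List A) → filterᵇ p (map f xs) ≡ map f (filterᵇ (p ∘ f) xs)
filterᵇ-map p f [] = refl
filterᵇ-map p f (x ∷ xs) with p (f x)
... | true  = cong (f x ∷_) (filterᵇ-map p f xs)
... | false = filterᵇ-map p f xs

range-suc : ∀ n → range (suc n) ≡ 1 ∷ map suc (range n)
range-suc n = cong (λ xs → 1 ∷ map suc xs) (sym (map-upTo suc n))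

map-punchIn-range : ∀ {p n} → p ≤ n → map (punchIn (suc p)) (range n) ≡ remove (suc p) (range (suc n))
map-punchIn-range {zero} {n} _ = begin
  map (punchIn 1) (map suc (upTo n))  ≡⟨ map-∘ (upTo n) ⟨
  map (suc ∘ suc) (upTo n)             ≡⟨ map-∘ (upTo n) ⟩
  map suc (range n)                    ≡⟨ cong (map suc) (filter-all (T? ∘ λ x → not (x ≡ᵇ 0)) (map⁺ (universal _ (upTo n)))) ⟨
  map suc (remove 0 (range n))         ≡⟨ filterᵇ-map (λ x → not (x ≡ᵇ 1)) suc (range n) ⟨
  remove 1 (map suc (range n))         ≡⟨ cong (remove 1) (range-suc n) ⟨
  remove 1 (range (suc n))             ∎
  where open ≡-Reasoning
map-punchIn-range {suc p} {suc n} (s≤s p≤n) = begin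
  map (punchIn (suc (suc p))) (range (suc n))          ≡⟨ cong (map _) (range-suc n) ⟩
  map (punchIn (suc (suc p))) (1 ∷ map suc (range n))  ≡⟨ cong (1 ∷_) (map-∘ (range n)) ⟨
  1 ∷ map (suc ∘ punchIn (suc p)) (range n)           ≡⟨ cong (1 ∷_) (map-∘ (range n)) ⟩
  1 ∷ map suc (map (punchIn (suc p)) (range n))        ≡⟨ cong (λ xs → 1 ∷ map suc xs) (map-punchIn-range p≤n) ⟩
  1 ∷ map suc (remove (suc p) (range (suc n)))         ≡⟨ cong (1 ∷_) (filterᵇ-map (λ x → not (x ≡ᵇ suc (suc p))) suc (range (suc n))) ⟨
  remove (suc (suc p)) (1 ∷ map suc (range (suc n)))   ≡⟨ cong (remove (suc (suc p))) (range-suc (suc n)) ⟨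
  remove (suc (suc p)) (range (suc (suc n)))           ∎
  where open ≡-Reasoning

filterᵇ-≡ᵇ-range : ∀ {p n} → p ≤ n → filterᵇ (_≡ᵇ suc p) (range (suc n)) ≡ [ suc p ]
filterᵇ-≡ᵇ-range {zero} {n} _ = begin
  filterᵇ (_≡ᵇ 1) (range (suc n))           ≡⟨ cong (filterᵇ (_≡ᵇ 1)) (range-suc n) ⟩
  1 ∷ filterᵇ (_≡ᵇ 1) (map suc (range n))   ≡⟨ cong (1 ∷_) (filterᵇ-map (_≡ᵇ 1) suc (range n)) ⟩
  1 ∷ map suc (filterᵇ (_≡ᵇ 0) (range n))   ≡⟨ cong (λ xs → 1 ∷ map suc xs) (filter-none (T? ∘ (_≡ᵇ 0)) (map⁺ (universal (λ _ ()) (upTo n)))) ⟩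
  [ 1 ]                                     ∎
  where open ≡-Reasoning
filterᵇ-≡ᵇ-range {suc p} {suc n} (s≤s p≤n) = begin
  filterᵇ (_≡ᵇ suc (suc p)) (range (suc (suc n)))           ≡⟨ cong (filterᵇ (_≡ᵇ suc (suc p))) (range-suc (suc n)) ⟩
  filterᵇ (_≡ᵇ suc (suc p)) (map suc (range (suc n)))       ≡⟨ filterᵇ-map (_≡ᵇ suc (suc p)) suc (range (suc n)) ⟩
  map suc (filterᵇ (_≡ᵇ suc p) (range (suc n)))             ≡⟨ cong (map suc) (filterᵇ-≡ᵇ-range p≤n) ⟩
  [ suc (suc p) ]                                          ∎
  where open ≡-Reasoning

expo-suc : ∀ n m → expo (suc n) (m + 1) ℤ.+ + 1 ≡ expo n m
expo-suc n m = begin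
  + (suc n + 1) ℤ.- + (2 * (m + 1)) ℤ.+ + 1
    ≡⟨ cong₂ (λ a b → a ℤ.- b ℤ.+ + 1) (ℤ.pos-+ 1 (n + 1)) (trans (cong +_ (*-distribˡ-+ 2 m 1)) (ℤ.pos-+ (2 * m) 2)) ⟩
  (+ 1 ℤ.+ + (n + 1)) ℤ.- (+ (2 * m) ℤ.+ + 2) ℤ.+ + 1
    ≡⟨ shift (+ (n + 1)) (+ (2 * m)) ⟩
  + (n + 1) ℤ.- + (2 * m)
    ∎
  where
  open ≡-Reasoning
  shift : ∀ a b → (+ 1 ℤ.+ a) ℤ.- (b ℤ.+ + 2) ℤ.+ + 1 ≡ a ℤ.- b
  shift = solve-∀

does-≟-+ : ∀ a e c → does (a ℤ.+ c ℤ.≟ e ℤ.+ c) ≡ does (a ℤ.≟ e)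
does-≟-+ a e c = does-⇔ (mk⇔ (∙-cancelʳ c a e) (cong (ℤ._+ c))) (a ℤ.+ c ℤ.≟ e ℤ.+ c) (a ℤ.≟ e)

CUDBelow : ℕ → ℕ → LPoly
CUDBelow n k = genFun (filterᵇ (isCUDBelow k) (notationsB n)) (λ σ → expo (suc n) (npkB σ + 1))

CUDD≡CUDBelow : ∀ {n p} → p ≤ n → ∀ e → CUDD (suc n) (suc p) e ≡ CUDBelow n (suc p) e
CUDD≡CUDBelow {n} {p} p≤n e = begin
  CUDD N K e
    ≡⟨ count-filterᵇ (isCUDD N K) hitsD (notationsD N) ⟩
  count selectD (notationsD N)
    ≡⟨ count-concatMap-filterᵇ selectD endingIn (_≡ᵇ K) (map⁺ {f = suc} (universal vanish (upTo N))) ⟩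
  count selectD (concatMap endingIn (filterᵇ (_≡ᵇ K) (range N)))
    ≡⟨ cong (count selectD ∘ concatMap endingIn) (filterᵇ-≡ᵇ-range p≤n) ⟩
  count selectD (endingIn K ++ [])
    ≡⟨ cong (count selectD) (++-identityʳ (endingIn K)) ⟩
  count selectD (endingIn K)
    ≡⟨ count-map selectD (_++ [ pairCycle K ]) (cycleNotations (remove K (range N))) ⟩
  count (selectD ∘ (_++ [ pairCycle K ])) (cycleNotations (remove K (range N)))
    ≡⟨ count-cong-local (All.map (λ {σ} → selectD-endingIn-K σ) (cycleNotations-nonEmpty (remove K (range N)))) ⟩
  count selectB (cycleNotations (remove K (range N)))
    ≡⟨ cong (count selectB ∘ cycleNotations) (map-punchIn-range p≤n) ⟨
  count selectB (cycleNotations (map (punchIn K) (range n)))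
    ≡⟨ cong (count selectB) (cycleNotations-map (punchIn K) refl (range n)) ⟩
  count selectB (map (relabelNotation (punchIn K)) (notationsB n))
    ≡⟨ count-map selectB (relabelNotation (punchIn K)) (notationsB n) ⟩
  count (selectB ∘ relabelNotation (punchIn K)) (notationsB n)
    ≡⟨ count-cong-local (universal selectB-relabel (notationsB n)) ⟩
  count selectB (notationsB n)
    ≡⟨ count-filterᵇ (isCUDBelow K) hitsB (notationsB n) ⟨
  CUDBelow n K e
    ∎
  where
  open ≡-Reasoning
  N K : ℕ
  N = suc n
  K = suc p
  hitsD : Notation → Bool
  hitsD ρ = does (expo N (npkD ρ) ℤ.≟ e)
  hitsB : Notation → Bool
  hitsB σ = does (expo N (npkB σ + 1) ℤ.≟ e)
  selectD : Notation → Bool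
  selectD ρ = isCUDD N K ρ ∧ hitsD ρ
  selectB : Notation → Bool
  selectB σ = isCUDBelow K σ ∧ hitsB σ
  endingIn : ℕ → List Notation
  endingIn a = map (_++ [ pairCycle a ]) (cycleNotations (remove a (range N)))

  selectD-endingIn : ∀ a σ → All NonEmpty σ → selectD (σ ++ [ pairCycle (suc a) ]) ≡ (isCUDBelow (suc a) σ ∧ (suc a ≡ᵇ K)) ∧ hitsB σ
  selectD-endingIn a σ ne = cong₂ _∧_ (isCUDD-snoc N K a σ ne) (cong (λ τ → does (expo N (npkB τ + 1) ℤ.≟ e)) (initCycles-snoc σ _))

  selectD-endingIn-K : ∀ σ → All NonEmpty σ → selectD (σ ++ [ pairCycle K ]) ≡ selectB σ
  selectD-endingIn-K σ ne = trans (selectD-endingIn p σ ne)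
    (cong (_∧ hitsB σ) (trans (cong (isCUDBelow K σ ∧_) (dec-true (K ≟ K) refl)) (∧-identityʳ _)))

  vanish : ∀ a → (suc a ≡ᵇ K) ≡ false → count selectD (endingIn (suc a)) ≡ 0
  vanish a a≢K = trans (count-map selectD (_++ [ pairCycle (suc a) ]) (cycleNotations (remove (suc a) (range N))))
    (count-none (All.map (λ {σ} ne → trans (selectD-endingIn a σ ne)
                   (cong (_∧ hitsB σ) (trans (cong (isCUDBelow (suc a) σ ∧_) a≢K) (∧-zeroʳ _))))
                 (cycleNotations-nonEmpty (remove (suc a) (range N)))))

  selectB-relabel : ∀ σ → selectB (relabelNotation (punchIn K) σ) ≡ selectB σ
  selectB-relabel σ = cong₂ _∧_ (isCUDBelow-relabel K (punchIn-<ᵇ K) σ)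
    (cong (λ m → does (expo N (m + 1) ℤ.≟ e)) (npkB-relabel σ))
    where open Relabel (punchIn K) refl (punchIn-mono K)

<ᵇ-suc-∧-≡ᵇ : ∀ x q → (x <ᵇ suc q) ∧ (x ≡ᵇ q) ≡ (x ≡ᵇ q)
<ᵇ-suc-∧-≡ᵇ zero    zero    = refl
<ᵇ-suc-∧-≡ᵇ zero    (suc q) = refl
<ᵇ-suc-∧-≡ᵇ (suc x) zero    = refl
<ᵇ-suc-∧-≡ᵇ (suc x) (suc q) = <ᵇ-suc-∧-≡ᵇ x q

<ᵇ-suc-∧-≢ᵇ : ∀ x q → (x <ᵇ suc q) ∧ not (x ≡ᵇ q) ≡ (x <ᵇ q)
<ᵇ-suc-∧-≢ᵇ zero    zero    = refl
<ᵇ-suc-∧-≢ᵇ zero    (suc q) = refl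
<ᵇ-suc-∧-≢ᵇ (suc x) zero    = refl
<ᵇ-suc-∧-≢ᵇ (suc x) (suc q) = <ᵇ-suc-∧-≢ᵇ x q

∧-refine-last : ∀ f u l w h → ((f ∧ u ∧ l) ∧ w) ∧ h ≡ (f ∧ u ∧ (l ∧ h)) ∧ w
∧-refine-last false u     l     w h = refl
∧-refine-last true  false l     w h = refl
∧-refine-last true  true  false w h = refl
∧-refine-last true  true  true  w h = ∧-comm w h

CUDBelow-suc : ∀ n q e → CUDBelow n (suc q) e ≡ CUDBelow n q e + tInv (CUDB n q) e
CUDBelow-suc n q e = begin
  CUDBelow n (suc q) e
    ≡⟨ count-filterᵇ (isCUDBelow (suc q)) hitsD (notationsB n) ⟩
  count selectBelow (notationsB n)
    ≡⟨ count-split selectBelow startsAtQ (notationsB n) ⟩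
  count (λ σ → selectBelow σ ∧ startsAtQ σ) (notationsB n) + count (λ σ → selectBelow σ ∧ not (startsAtQ σ)) (notationsB n)
    ≡⟨ cong₂ _+_ (count-cong-local (universal startsAtQ-part (notationsB n)))
                 (count-cong-local (universal belowQ-part (notationsB n))) ⟩
  count (λ σ → isCUDB n q σ ∧ hitsB σ) (notationsB n) + count (λ σ → isCUDBelow q σ ∧ hitsD σ) (notationsB n)
    ≡⟨ cong₂ _+_ (count-filterᵇ (isCUDB n q) hitsB (notationsB n)) (count-filterᵇ (isCUDBelow q) hitsD (notationsB n)) ⟨
  tInv (CUDB n q) e + CUDBelow n q e
    ≡⟨ +-comm (tInv (CUDB n q) e) _ ⟩
  CUDBelow n q e + tInv (CUDB n q) e
    ∎
  where
  open ≡-Reasoning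
  hitsD : Notation → Bool
  hitsD σ = does (expo (suc n) (npkB σ + 1) ℤ.≟ e)
  hitsB : Notation → Bool
  hitsB σ = does (expo n (npkB σ) ℤ.≟ e ℤ.+ + 1)
  selectBelow : Notation → Bool
  selectBelow σ = isCUDBelow (suc q) σ ∧ hitsD σ
  startsAtQ : Notation → Bool
  startsAtQ σ = lastFirst σ ≡ᵇ q

  startsAtQ-part : ∀ σ → selectBelow σ ∧ startsAtQ σ ≡ isCUDB n q σ ∧ hitsB σ
  startsAtQ-part σ = trans (∧-refine-last (all firstPos σ) (isCycleUpDown (absB σ)) _ (hitsD σ) (startsAtQ σ))
    (cong₂ (λ l w → (all firstPos σ ∧ isCycleUpDown (absB σ) ∧ l) ∧ w) (<ᵇ-suc-∧-≡ᵇ (lastFirst σ) q)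
      (trans (sym (does-≟-+ (expo (suc n) (npkB σ + 1)) e (+ 1)))
             (cong (λ a → does (a ℤ.≟ e ℤ.+ + 1)) (expo-suc n (npkB σ)))))

  belowQ-part : ∀ σ → selectBelow σ ∧ not (startsAtQ σ) ≡ isCUDBelow q σ ∧ hitsD σ
  belowQ-part σ = trans (∧-refine-last (all firstPos σ) (isCycleUpDown (absB σ)) _ (hitsD σ) (not (startsAtQ σ)))
    (cong (λ l → (all firstPos σ ∧ isCycleUpDown (absB σ) ∧ l) ∧ hitsD σ) (<ᵇ-suc-∧-≢ᵇ (lastFirst σ) q))

proposition3p1 : (n k : ℕ) → 1 < k → k ≤ n →
    (e : ℤ) → CUDD n k e ≡ (CUDD n (k ∸ 1) ⊕ tInv (CUDB (n ∸ 1) (k ∸ 1))) e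
proposition3p1 (suc n) (suc (suc j)) (s≤s (s≤s z≤n)) (s≤s j<n) e = begin
  CUDD (suc n) (suc (suc j)) e                       ≡⟨ CUDD≡CUDBelow j<n e ⟩
  CUDBelow n (suc (suc j)) e                         ≡⟨ CUDBelow-suc n (suc j) e ⟩
  CUDBelow n (suc j) e + tInv (CUDB n (suc j)) e     ≡⟨ cong (_+ tInv (CUDB n (suc j)) e) (CUDD≡CUDBelow (<⇒≤ j<n) e) ⟨
  CUDD (suc n) (suc j) e + tInv (CUDB n (suc j)) e   ∎
  where open ≡-Reasoning
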